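{- Let $G$ be a finite simple graph of order $n$ and let $u$ be a vertex of $G$. Then \[\mathrm{dp}_{G^{c}}(u)=\big(\mathrm{dp}(G)-\mathrm{dp}_G(u)-x^{\deg_G u}\big)^{\curlywedge (n-1)- }.\]
   Context: For a vertex $w$ of a simple graph $\Gamma$, the degree polynomial $\mathrm{dp}_\Gamma(w)$ is the polynomial whose coefficient of $x^{i}$ is the number of neighbours of $w$ having degree $i$ in $\Gamma$ ($0$ if $w$ is isolated). $\mathrm{dp}(G)=\sum_{i\ge0}t_i x^i$ where $t_i$ is the number of vertices of $G$ of degree $i$. $G^{c}$ is the complement of $G$. For a polynomial $f=\sum_{a_i\neq0}a_i x^i$ with nonnegative integer coefficients and $\deg f\le m$, $f^{\curlywedge m- }=\sum_{a_i\neq0}a_i x^{m-i}$, and $0^{\curlywedge m- }=0$. -}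

module Defs where

open import Data.Nat using (ℕ; zero; suc; _∸_; _≤ᵇ_; _≡ᵇ_)
open import Data.Bool using (Bool; true; false; if_then_else_; not; _∧_)
open import Data.Fin using (Fin; _≟_)
open import Data.List using (List; sum; map; filter; length)
open import Data.List.Base using (allFin)
open import Relation.Nullary.Decidable using (⌊_⌋)
open import Relation.Binary.PropositionalEquality using (_≡_)

record SimpleGraph (n : ℕ) : Set where
  field
    adj    : Fin n → Fin n → Bool
    sym    : ∀ v w → adj v w ≡ adj w v
    irrefl : ∀ v → adj v v ≡ false
open SimpleGraph public

count : ∀ {n} → (Fin n → Bool) → ℕ
count {n} p = length (filter (λ v → Data.Bool._≟_ (p v) true) (allFin n))

deg : ∀ {n} → SimpleGraph n → Fin n → ℕ
deg G w = count (adj G w)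

-- Polynomials with nonnegative integer coefficients, represented by their
-- coefficient function (coefficient of x^i).  Equality = coefficientwise.
Poly : Set
Poly = ℕ → ℕ

_≈P_ : Poly → Poly → Set
f ≈P g = ∀ i → f i ≡ g i

xpow : ℕ → Poly
xpow k i = if k ≡ᵇ i then 1 else 0

-- coefficientwise subtraction (only applied where the true
-- difference is nonnegative)
_-P_ : Poly → Poly → Poly
(f -P g) i = f i ∸ g i

dpV : ∀ {n} → SimpleGraph n → Fin n → Poly
dpV G w i = count (λ v → adj G w v ∧ (deg G v ≡ᵇ i))

dpG : ∀ {n} → SimpleGraph n → Poly
dpG G i = count (λ v → deg G v ≡ᵇ i)

-- f^{⋏ m-}: coefficient of x^j is the coefficient of x^(m-j) in f, for j ≤ m,
-- and 0 for j > m  (i.e. sum a_i x^(m-i) for deg f ≤ m)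
flip : ℕ → Poly → Poly
flip m f j = if j ≤ᵇ m then f (m ∸ j) else 0

complement : ∀ {n} → SimpleGraph n → SimpleGraph n
complement {n} G = record
  { adj = λ v w → not (adj G v w) ∧ not ⌊ v ≟ w ⌋
  ; sym = symc
  ; irrefl = irc
  }
  where
  open import Relation.Binary.PropositionalEquality using (refl; cong₂; cong; sym)
  open import Relation.Nullary using (yes; no)
  symc : ∀ v w → (not (adj G v w) ∧ not ⌊ v ≟ w ⌋) ≡ (not (adj G w v) ∧ not ⌊ w ≟ v ⌋)
  symc v w with v ≟ w | w ≟ v
  ... | yes p | yes q = cong₂ _∧_ (cong not (SimpleGraph.sym G v w)) refl
  ... | yes refl | no q with q refl
  ... | ()
  symc v w | no p | yes refl with p refl
  ... | ()
  symc v w | no p | no q = cong₂ _∧_ (cong not (SimpleGraph.sym G v w)) refl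
  irc : ∀ v → (not (adj G v v) ∧ not ⌊ v ≟ v ⌋) ≡ false
  irc v with v ≟ v
  ... | yes _ = Data.Bool.Properties.∧-zeroʳ _
    where import Data.Bool.Properties
  ... | no ¬p with ¬p refl
  ... | ()

-- In the complement, the neighbours of u are the vertices other than u that are not
-- adjacent to u in G, and each vertex v has degree (n - 1) - deg v there.  So the
-- coefficient of x^j in dp_{G^c}(u) counts the non-neighbours v ≠ u of degree
-- (n - 1) - j in G.  Splitting the vertices of G into the neighbours of u, u itself,
-- and the non-neighbours v ≠ u shows that this number is the coefficient of
-- x^((n-1)-j) in dp(G) - dp_G(u) - x^(deg u).
module Submission where

open import Defs hiding (sym)
open import Data.Nat using (ℕ; zero; suc; _+_; _∸_; _≤_; _≡ᵇ_)
open import Data.Nat.Properties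
  using (_≤?_; m∸[m∸n]≡n; m+n∸m≡n; m≤m+n; +-suc; +-identityʳ)
  renaming (_≟_ to _≟ℕ_)
open import Data.Fin using (Fin; _≟_)
import Data.Fin as Fin
open import Data.Bool using (Bool; true; false; if_then_else_; not; _∧_)
open import Data.Bool.Properties using (∧-assoc; ∧-comm; ∧-identityʳ; ∧-zeroʳ)
open import Data.List using (length; filter; tabulate)
open import Function using (_∘_; _⇔_; mk⇔)
open import Relation.Nullary using (¬_; yes; no)
open import Relation.Nullary.Decidable using (⌊_⌋; dec-true; dec-false; does-⇔; ⌊⌋-map′)
open import Relation.Binary.PropositionalEquality
  using (_≡_; refl; sym; trans; cong; cong₂; subst; module ≡-Reasoning)

open ≡-Reasoning

boolToℕ : Bool → ℕ
boolToℕ b = if b then 1 else 0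

m∸n≡o⇔n≡m∸o : ∀ {m n o} → n ≤ m → o ≤ m → (m ∸ n ≡ o ⇔ n ≡ m ∸ o)
m∸n≡o⇔n≡m∸o {m} n≤m o≤m = mk⇔
  (λ m∸n≡o → trans (sym (m∸[m∸n]≡n n≤m)) (cong (m ∸_) m∸n≡o))
  (λ n≡m∸o → trans (cong (m ∸_) n≡m∸o) (m∸[m∸n]≡n o≤m))

count-tabulate : ∀ {m n} (p : Fin m → Bool) (f : Fin n → Fin m) →
  length (filter (λ v → Data.Bool._≟_ (p v) true) (tabulate f)) ≡ count (p ∘ f)
count-tabulate {n = zero}  p f = refl
count-tabulate {n = suc n} p f with p (f Fin.zero)
... | true  = cong suc (trans (count-tabulate p (f ∘ Fin.suc))
                              (sym (count-tabulate (p ∘ f) Fin.suc)))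
... | false = trans (count-tabulate p (f ∘ Fin.suc)) (sym (count-tabulate (p ∘ f) Fin.suc))

count-suc : ∀ {n} (p : Fin (suc n) → Bool) → count p ≡ boolToℕ (p Fin.zero) + count (p ∘ Fin.suc)
count-suc p with p Fin.zero
... | true  = cong suc (count-tabulate p Fin.suc)
... | false = count-tabulate p Fin.suc

count-cong : ∀ {n} {p q : Fin n → Bool} → (∀ v → p v ≡ q v) → count p ≡ count q
count-cong {zero}  p≗q = refl
count-cong {suc n} {p} {q} p≗q = begin
  count p                                      ≡⟨ count-suc p ⟩
  boolToℕ (p Fin.zero) + count (p ∘ Fin.suc)   ≡⟨ cong₂ _+_ (cong boolToℕ (p≗q Fin.zero))
                                                             (count-cong (p≗q ∘ Fin.suc)) ⟩
  boolToℕ (q Fin.zero) + count (q ∘ Fin.suc)   ≡⟨ count-suc q ⟨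
  count q                                      ∎

count-false : ∀ {n} (p : Fin n → Bool) → (∀ v → p v ≡ false) → count p ≡ 0
count-false {zero}  p p≗false = refl
count-false {suc n} p p≗false = begin
  count p                                      ≡⟨ count-suc p ⟩
  boolToℕ (p Fin.zero) + count (p ∘ Fin.suc)   ≡⟨ cong₂ _+_ (cong boolToℕ (p≗false Fin.zero))
                                                             (count-false _ (p≗false ∘ Fin.suc)) ⟩
  0                                            ∎

count-true : ∀ n → count {n} (λ _ → true) ≡ n
count-true zero    = refl
count-true (suc n) = trans (count-suc {n} (λ _ → true)) (cong suc (count-true n))

count-partition : ∀ {n} (p q : Fin n → Bool) →
  count p ≡ count (λ v → p v ∧ q v) + count (λ v → p v ∧ not (q v))
count-partition {zero}  p q = refl
count-partition {suc n} p q = begin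
  count p
    ≡⟨ count-suc p ⟩
  boolToℕ (p Fin.zero) + count (p ∘ Fin.suc)
    ≡⟨ cong (boolToℕ (p Fin.zero) +_) (count-partition (p ∘ Fin.suc) (q ∘ Fin.suc)) ⟩
  boolToℕ (p Fin.zero) + (count (λ v → p (Fin.suc v) ∧ q (Fin.suc v))
                          + count (λ v → p (Fin.suc v) ∧ not (q (Fin.suc v))))
    ≡⟨ split-head (p Fin.zero) (q Fin.zero) ⟩
  (boolToℕ (p Fin.zero ∧ q Fin.zero) + count (λ v → p (Fin.suc v) ∧ q (Fin.suc v)))
    + (boolToℕ (p Fin.zero ∧ not (q Fin.zero))
       + count (λ v → p (Fin.suc v) ∧ not (q (Fin.suc v))))
    ≡⟨ cong₂ _+_ (count-suc (λ v → p v ∧ q v)) (count-suc (λ v → p v ∧ not (q v))) ⟨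
  count (λ v → p v ∧ q v) + count (λ v → p v ∧ not (q v))
    ∎
  where
  split-head : ∀ a b {k l} → boolToℕ a + (k + l) ≡
               (boolToℕ (a ∧ b) + k) + (boolToℕ (a ∧ not b) + l)
  split-head true  true  = refl
  split-head true  false {k} {l} = sym (+-suc k l)
  split-head false _     = refl

count-at : ∀ {n} (u : Fin n) (p : Fin n → Bool) → count (λ v → p v ∧ ⌊ u ≟ v ⌋) ≡ boolToℕ (p u)
count-at {suc n} Fin.zero p = begin
  count (λ v → p v ∧ ⌊ Fin.zero ≟ v ⌋)
    ≡⟨ count-suc {n} (λ v → p v ∧ ⌊ Fin.zero ≟ v ⌋) ⟩
  boolToℕ (p Fin.zero ∧ true) + count (λ v → p (Fin.suc v) ∧ false)
    ≡⟨ cong₂ _+_ (cong boolToℕ (∧-identityʳ (p Fin.zero)))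
                 (count-false _ (∧-zeroʳ ∘ p ∘ Fin.suc)) ⟩
  boolToℕ (p Fin.zero) + 0
    ≡⟨ +-identityʳ _ ⟩
  boolToℕ (p Fin.zero)
    ∎
count-at {suc n} (Fin.suc u) p = begin
  count (λ v → p v ∧ ⌊ Fin.suc u ≟ v ⌋)
    ≡⟨ count-suc {n} (λ v → p v ∧ ⌊ Fin.suc u ≟ v ⌋) ⟩
  boolToℕ (p Fin.zero ∧ false) + count (λ v → p (Fin.suc v) ∧ ⌊ Fin.suc u ≟ Fin.suc v ⌋)
    ≡⟨ cong₂ _+_ (cong boolToℕ (∧-zeroʳ (p Fin.zero)))
                 (count-cong (λ v → cong (p (Fin.suc v) ∧_) (⌊⌋-map′ _ _ (u ≟ v)))) ⟩
  0 + count (λ v → p (Fin.suc v) ∧ ⌊ u ≟ v ⌋)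
    ≡⟨ count-at u (p ∘ Fin.suc) ⟩
  boolToℕ (p (Fin.suc u))
    ∎

count-remove : ∀ {n} (u : Fin n) (p : Fin n → Bool) →
  count p ≡ boolToℕ (p u) + count (λ v → p v ∧ not ⌊ u ≟ v ⌋)
count-remove u p =
  trans (count-partition p (λ v → ⌊ u ≟ v ⌋))
        (cong (_+ count (λ v → p v ∧ not ⌊ u ≟ v ⌋)) (count-at u p))

deg+deg-complement : ∀ {n} (G : SimpleGraph n) (v : Fin n) →
  suc (deg G v + deg (complement G) v) ≡ n
deg+deg-complement {n} G v = begin
  suc (deg G v + deg (complement G) v)
    ≡⟨ +-suc (deg G v) _ ⟨
  deg G v + suc (deg (complement G) v)
    ≡⟨ cong (λ b → deg G v + (boolToℕ (not b) + deg (complement G) v)) (irrefl G v) ⟨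
  deg G v + (boolToℕ (not (adj G v v)) + deg (complement G) v)
    ≡⟨ cong (deg G v +_) (count-remove v (not ∘ adj G v)) ⟨
  deg G v + count (not ∘ adj G v)
    ≡⟨ count-partition (λ _ → true) (adj G v) ⟨
  count {n} (λ _ → true)
    ≡⟨ count-true n ⟩
  n ∎

deg+deg-complement≡n∸1 : ∀ {n} (G : SimpleGraph n) (v : Fin n) →
  deg G v + deg (complement G) v ≡ n ∸ 1
deg+deg-complement≡n∸1 G v = cong (_∸ 1) (deg+deg-complement G v)

deg-complement : ∀ {n} (G : SimpleGraph n) (v : Fin n) →
  deg (complement G) v ≡ (n ∸ 1) ∸ deg G v
deg-complement G v = trans (sym (m+n∸m≡n (deg G v) _))
                           (cong (_∸ deg G v) (deg+deg-complement≡n∸1 G v))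

deg≤n∸1 : ∀ {n} (G : SimpleGraph n) (v : Fin n) → deg G v ≤ n ∸ 1
deg≤n∸1 G v = subst (deg G v ≤_) (deg+deg-complement≡n∸1 G v) (m≤m+n (deg G v) _)

deg-complement≡ᵇ : ∀ {n} (G : SimpleGraph n) (v : Fin n) {j} → j ≤ n ∸ 1 →
  (deg (complement G) v ≡ᵇ j) ≡ (deg G v ≡ᵇ (n ∸ 1) ∸ j)
deg-complement≡ᵇ {n} G v {j} j≤n∸1 = trans (cong (_≡ᵇ j) (deg-complement G v))
  (does-⇔ (m∸n≡o⇔n≡m∸o (deg≤n∸1 G v) j≤n∸1) (_ ≟ℕ j) (deg G v ≟ℕ _))

deg-complement≢ : ∀ {n} (G : SimpleGraph n) (v : Fin n) {j} → ¬ j ≤ n ∸ 1 →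
  (deg (complement G) v ≡ᵇ j) ≡ false
deg-complement≢ {n} G v {j} j≰n∸1 = dec-false (deg (complement G) v ≟ℕ j)
  (λ deg≡j → j≰n∸1 (subst (_≤ n ∸ 1) deg≡j (deg≤n∸1 (complement G) v)))

dpV-complement : ∀ {n} (G : SimpleGraph n) (u : Fin n) {j} → j ≤ n ∸ 1 →
  dpV (complement G) u j ≡ count (λ v → adj (complement G) u v ∧ (deg G v ≡ᵇ (n ∸ 1) ∸ j))
dpV-complement G u j≤n∸1 =
  count-cong (λ v → cong (adj (complement G) u v ∧_) (deg-complement≡ᵇ G v j≤n∸1))

dpV-complement-vanishes : ∀ {n} (G : SimpleGraph n) (u : Fin n) {j} → ¬ j ≤ n ∸ 1 →
  dpV (complement G) u j ≡ 0
dpV-complement-vanishes G u j≰n∸1 = count-false _ (λ v →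
  trans (cong (adj (complement G) u v ∧_) (deg-complement≢ G v j≰n∸1)) (∧-zeroʳ _))

dpG≡dpV+xpow+complement : ∀ {n} (G : SimpleGraph n) (u : Fin n) i →
  dpG G i ≡ dpV G u i + (xpow (deg G u) i + count (λ v → adj (complement G) u v ∧ (deg G v ≡ᵇ i)))
dpG≡dpV+xpow+complement {n} G u i = begin
  count hasDegree
    ≡⟨ count-partition hasDegree (adj G u) ⟩
  count (λ v → hasDegree v ∧ adj G u v) + count (λ v → hasDegree v ∧ not (adj G u v))
    ≡⟨ cong₂ _+_ (count-cong (λ v → ∧-comm (hasDegree v) (adj G u v)))
                 (count-remove u (λ v → hasDegree v ∧ not (adj G u v))) ⟩
  dpV G u i + (boolToℕ (hasDegree u ∧ not (adj G u u))
               + count (λ v → (hasDegree v ∧ not (adj G u v)) ∧ not ⌊ u ≟ v ⌋))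
    ≡⟨ cong (dpV G u i +_) (cong₂ _+_ atU (count-cong rotate)) ⟩
  dpV G u i + (xpow (deg G u) i + count (λ v → adj (complement G) u v ∧ hasDegree v))
    ∎
  where
  hasDegree : Fin n → Bool
  hasDegree v = deg G v ≡ᵇ i
  atU : boolToℕ (hasDegree u ∧ not (adj G u u)) ≡ xpow (deg G u) i
  atU = cong boolToℕ (trans (cong (λ b → hasDegree u ∧ not b) (irrefl G u))
                            (∧-identityʳ (hasDegree u)))
  rotate : ∀ v → ((hasDegree v ∧ not (adj G u v)) ∧ not ⌊ u ≟ v ⌋)
                 ≡ (adj (complement G) u v ∧ hasDegree v)
  rotate v = trans (∧-assoc (hasDegree v) _ _) (∧-comm (hasDegree v) _)

flip-≤ : ∀ {m j} (f : Poly) → j ≤ m → flip m f j ≡ f (m ∸ j)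
flip-≤ {m} {j} f j≤m = cong (λ b → if b then f (m ∸ j) else 0) (dec-true (j ≤? m) j≤m)

flip-≰ : ∀ {m j} (f : Poly) → ¬ j ≤ m → flip m f j ≡ 0
flip-≰ {m} {j} f j≰m = cong (λ b → if b then f (m ∸ j) else 0) (dec-false (j ≤? m) j≰m)

theorem4p19 : ∀ (n : ℕ) (G : SimpleGraph n) (u : Fin n) →
    dpV (complement G) u ≈P flip (n ∸ 1) ((dpG G -P dpV G u) -P xpow (deg G u))
theorem4p19 n G u j with j ≤? n ∸ 1
... | no j≰n∸1 = trans (dpV-complement-vanishes G u j≰n∸1)
                       (sym (flip-≰ ((dpG G -P dpV G u) -P xpow (deg G u)) j≰n∸1))
... | yes j≤n∸1 = begin
  dpV (complement G) u j                     ≡⟨ dpV-complement G u j≤n∸1 ⟩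
  nonNeighbours                              ≡⟨ m+n∸m≡n (xpow (deg G u) i) _ ⟨
  (xpow (deg G u) i + nonNeighbours) ∸ xpow (deg G u) i
    ≡⟨ cong (_∸ xpow (deg G u) i) (m+n∸m≡n (dpV G u i) _) ⟨
  (dpV G u i + (xpow (deg G u) i + nonNeighbours)) ∸ dpV G u i ∸ xpow (deg G u) i
    ≡⟨ cong (λ k → k ∸ dpV G u i ∸ xpow (deg G u) i) (dpG≡dpV+xpow+complement G u i) ⟨
  dpG G i ∸ dpV G u i ∸ xpow (deg G u) i     ≡⟨ flip-≤ ((dpG G -P dpV G u) -P xpow (deg G u)) j≤n∸1 ⟨
  flip (n ∸ 1) ((dpG G -P dpV G u) -P xpow (deg G u)) j
    ∎
  where
  i : ℕ
  i = (n ∸ 1) ∸ j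
  nonNeighbours : ℕ
  nonNeighbours = count (λ v → adj (complement G) u v ∧ (deg G v ≡ᵇ i))
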